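{- Let $(F_n)_{n\ge 0}$ be the Fibonacci sequence, $F_0=0$, $F_1=1$, $F_n=F_{n-1}+F_{n-2}$ for $n\ge 2$, and let $N$ be a positive integer. If $F$ is a positive Fibonacci number and there is an integer $d$ with $0\le d\le 10^N-1$ such that $10^NF+d$ is a Fibonacci number, then $F$ has at most $N+1$ decimal digits. Consequently, in any sequence $a_1,a_2,\dots$ of positive Fibonacci numbers with $a_{i+1}=10^Na_i+d_i$, $0\le d_i\le 10^N-1$, for all consecutive terms, there are at most two appending steps, i.e., the sequence has at most $3$ terms.
   Context: Appending exactly $N$ digits to a number $a$ means forming $10^N a+d$ with $0\le d\le 10^N-1$ (leading zeros allowed). -}

module Defs where

open import Data.Nat using (ℕ; zero; suc; _+_; _*_; _∸_; _^_; _≤_; _<_)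
open import Data.Product using (Σ; ∃; _×_)
open import Relation.Binary.PropositionalEquality using (_≡_)

fib : ℕ → ℕ
fib zero = 0
fib (suc zero) = 1
fib (suc (suc n)) = fib (suc n) + fib n

IsFib : ℕ → Set
IsFib x = ∃ λ n → fib n ≡ x

Appends : ℕ → ℕ → ℕ → Set
Appends N a b = ∃ λ d → d ≤ 10 ^ N ∸ 1 × b ≡ 10 ^ N * a + d

-- Let F = F_m and F_k = M F + d with 0 ≤ d < M. If k ≤ m then F_k ≤ F < 2F, and if k ≥ 2m then
-- F_k ≥ F_2m = L_m F ≥ F², which is too large once F > M. Otherwise k = m + j with 0 < j < m, and
-- F_(m+j) = L_j F_m − (−1)^j F_(m−j). When M is not a Lucas number (for M = 10^N: no Lucas number is
-- divisible by 5), the distinct multiples M F and L_j F lie within d + F_(m−j) of each other, so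
-- F ≤ d + F_(m−1); as 3F_(m−1) ≤ 2F + 1, this gives F ≤ 3d + 1 < 3M ≤ 10^(N+1). In a chain a₁ → a₂ → a₃ → a₄ this
-- bound on a₃ contradicts a₃ ≥ 10^(2N) a₁ ≥ 10^(N+1).
module Submission where

open import Defs
open import Data.Nat using (ℕ; _+_; _*_; _∸_; _^_; _≤_; _<_)
open import Data.Product using (_×_)
open import Data.List using (List; length)
open import Data.List.Relation.Unary.All using (All)
open import Data.List.Relation.Unary.Linked using (Linked)
open import Relation.Binary.PropositionalEquality using (_≡_)

open import Data.Nat
open import Data.Nat.Properties
open import Data.Nat.Divisibility using (_∣_; _∤_; _∣?_; divides; ∣-trans; ∣m+n∣m⇒∣n; m∣m*n)
open import Data.Nat.Tactic.RingSolver using (solve; solve-∀)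
open import Data.Product using (∃₂; _,_)
open import Data.Empty using (⊥; ⊥-elim)
open import Data.List using (_∷_; [])
import Data.List.Relation.Unary.All as All
import Data.List.Relation.Unary.Linked as Linked
open import Function.Base using (_∘_)
open import Relation.Binary.Definitions using (tri<; tri≈; tri>)
open import Relation.Binary.PropositionalEquality
open import Relation.Nullary using (Dec; yes; no; contradiction)
open import Relation.Nullary.Decidable using (from-no)

fib-≤-suc : ∀ n → fib n ≤ fib (suc n)
fib-≤-suc zero    = z≤n
fib-≤-suc (suc n) = m≤m+n (fib (suc n)) (fib n)

fib-mono-≤ : ∀ {m n} → m ≤ n → fib m ≤ fib n
fib-mono-≤ = go ∘ ≤⇒≤′
  where
  go : ∀ {m n} → m ≤′ n → fib m ≤ fib n
  go ≤′-refl       = ≤-refl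
  go (≤′-step {n} m≤n) = ≤-trans (go m≤n) (fib-≤-suc n)

3*fib≤2*fib[1+n]+1 : ∀ n → 3 * fib n ≤ 2 * fib (suc n) + 1
3*fib≤2*fib[1+n]+1 zero          = z≤n
3*fib≤2*fib[1+n]+1 (suc zero)    = ≤-refl
3*fib≤2*fib[1+n]+1 (suc (suc n)) = bound (fib (suc n)) (fib n) (fib-≤-suc n)
  where
  open ≤-Reasoning
  bound : ∀ a b → b ≤ a → 3 * (a + b) ≤ 2 * (a + b + a) + 1
  bound a b b≤a = begin
    3 * (a + b)           ≡⟨ solve (a ∷ b ∷ []) ⟩
    2 * (a + b) + (a + b) ≤⟨ +-monoʳ-≤ (2 * (a + b)) (+-monoʳ-≤ a b≤a) ⟩
    2 * (a + b) + (a + a) ≡⟨ solve (a ∷ b ∷ []) ⟩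
    2 * (a + b + a)       ≤⟨ m≤m+n _ 1 ⟩
    2 * (a + b + a) + 1   ∎

luc : ℕ → ℕ
luc zero          = 2
luc (suc zero)    = 1
luc (suc (suc n)) = luc (suc n) + luc n

fib≤luc : ∀ n → fib n ≤ luc n
fib≤luc zero          = z≤n
fib≤luc (suc zero)    = ≤-refl
fib≤luc (suc (suc n)) = +-mono-≤ (fib≤luc (suc n)) (fib≤luc n)

luc[2+n]+luc[n]≡5*fib[1+n] : ∀ n → luc (2 + n) + luc n ≡ 5 * fib (1 + n)
luc[2+n]+luc[n]≡5*fib[1+n] zero          = refl
luc[2+n]+luc[n]≡5*fib[1+n] (suc zero)    = refl
luc[2+n]+luc[n]≡5*fib[1+n] (suc (suc n)) = begin
  luc (4 + n) + luc (2 + n)                           ≡⟨ regroup (luc (3 + n)) (luc (1 + n)) (luc n) ⟩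
  (luc (3 + n) + luc (1 + n)) + (luc (2 + n) + luc n) ≡⟨ cong₂ _+_ (luc[2+n]+luc[n]≡5*fib[1+n] (suc n)) (luc[2+n]+luc[n]≡5*fib[1+n] n) ⟩
  5 * fib (2 + n) + 5 * fib (1 + n)                   ≡⟨ *-distribˡ-+ 5 (fib (2 + n)) (fib (1 + n)) ⟨
  5 * fib (3 + n)                                     ∎
  where
  open ≡-Reasoning
  regroup : ∀ x y z → x + (y + z) + (y + z) ≡ x + y + (y + z + z)
  regroup = solve-∀

luc[4+n]≡5*fib[2+n]+luc[n] : ∀ n → luc (4 + n) ≡ 5 * fib (2 + n) + luc n
luc[4+n]≡5*fib[2+n]+luc[n] n = begin
  luc (3 + n) + (luc (1 + n) + luc n) ≡⟨ +-assoc (luc (3 + n)) (luc (1 + n)) (luc n) ⟨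
  luc (3 + n) + luc (1 + n) + luc n   ≡⟨ cong (_+ luc n) (luc[2+n]+luc[n]≡5*fib[1+n] (suc n)) ⟩
  5 * fib (2 + n) + luc n             ∎
  where open ≡-Reasoning

5∤luc : ∀ n → 5 ∤ luc n
5∤luc 0 = from-no (5 ∣? 2)
5∤luc 1 = from-no (5 ∣? 1)
5∤luc 2 = from-no (5 ∣? 3)
5∤luc 3 = from-no (5 ∣? 4)
5∤luc (suc (suc (suc (suc n)))) 5∣luc[4+n] =
  5∤luc n (∣m+n∣m⇒∣n (subst (5 ∣_) (luc[4+n]≡5*fib[2+n]+luc[n] n) 5∣luc[4+n]) (m∣m*n (fib (2 + n))))

evenBit oddBit : ℕ → ℕ
evenBit zero    = 1
evenBit (suc j) = oddBit j
oddBit zero    = 0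
oddBit (suc j) = evenBit j

evenBit-*-≤ : ∀ j x → evenBit j * x ≤ x
oddBit-*-≤ : ∀ j x → oddBit j * x ≤ x
evenBit-*-≤ zero    x = ≤-reflexive (+-identityʳ x)
evenBit-*-≤ (suc j)   = oddBit-*-≤ j
oddBit-*-≤ zero    x = z≤n
oddBit-*-≤ (suc j)   = evenBit-*-≤ j

add-and-cancel : ∀ {x y a A B} e o L₁ L₀ →
  x + o * A ≡ L₁ * a + e * A →
  y + e * (A + B) ≡ L₀ * a + o * (A + B) →
  x + y + e * B ≡ (L₁ + L₀) * a + o * B
add-and-cancel {x} {y} {a} {A} {B} e o L₁ L₀ h₁ h₀ = +-cancelʳ-≡ ((e + o) * A) _ _ (begin
  x + y + e * B + (e + o) * A                 ≡⟨ solve (x ∷ y ∷ A ∷ B ∷ e ∷ o ∷ []) ⟩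
  (x + o * A) + (y + e * (A + B))             ≡⟨ cong₂ _+_ h₁ h₀ ⟩
  (L₁ * a + e * A) + (L₀ * a + o * (A + B))   ≡⟨ solve (a ∷ A ∷ B ∷ e ∷ o ∷ L₁ ∷ L₀ ∷ []) ⟩
  (L₁ + L₀) * a + o * B + (e + o) * A         ∎)
  where open ≡-Reasoning

-- F_(n+j) + (−1)^j F_(n−j) = L_j F_n with r = n − j, the sign term moved to the side where it is added.
fib-luc : ∀ j r {n} → j + r ≡ n → fib (j + n) + evenBit j * fib r ≡ luc j * fib n + oddBit j * fib r
fib-luc 0 r refl = sym (+-identityʳ _)
fib-luc 1 r refl = base (fib (suc r)) (fib r)
  where
  base : ∀ a b → a + b + 0 * b ≡ 1 * a + 1 * b
  base = solve-∀
fib-luc (suc (suc j)) r refl =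
  add-and-cancel (evenBit j) (oddBit j) (luc (suc j)) (luc j)
    (fib-luc (suc j) (suc r) (cong suc (+-suc j r)))
    (fib-luc j (suc (suc r)) (trans (+-suc j (suc r)) (cong suc (+-suc j r))))

fib[m+m]≡luc[m]*fib[m] : ∀ m → fib (m + m) ≡ luc m * fib m
fib[m+m]≡luc[m]*fib[m] m = begin
  fib (m + m)                           ≡⟨ +-identityʳ _ ⟨
  fib (m + m) + 0                       ≡⟨ cong (fib (m + m) +_) (*-zeroʳ (evenBit m)) ⟨
  fib (m + m) + evenBit m * 0           ≡⟨ fib-luc m 0 (+-identityʳ m) ⟩
  luc m * fib m + oddBit m * 0          ≡⟨ cong (luc m * fib m +_) (*-zeroʳ (oddBit m)) ⟩
  luc m * fib m + 0                     ≡⟨ +-identityʳ _ ⟩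
  luc m * fib m                         ∎
  where open ≡-Reasoning

<⇒multiples-gap : ∀ {L M F y} → L < M → M * F ≤ L * F + y → F ≤ y
<⇒multiples-gap {L} {M} {F} {y} L<M MF≤LF+y = +-cancelˡ-≤ (L * F) F y (begin
  L * F + F ≡⟨ +-comm (L * F) F ⟩
  suc L * F ≤⟨ *-monoˡ-≤ F L<M ⟩
  M * F     ≤⟨ MF≤LF+y ⟩
  L * F + y ∎)
  where open ≤-Reasoning

≢⇒multiples-gap : ∀ {L M F y} → L ≢ M → L * F ≤ M * F + y → M * F ≤ L * F + y → F ≤ y
≢⇒multiples-gap {L} {M} L≢M LF≤MF+y MF≤LF+y with <-cmp L M
... | tri< L<M _   _   = <⇒multiples-gap L<M MF≤LF+y
... | tri≈ _   L≡M _   = contradiction L≡M L≢M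
... | tri> _   _   M<L = <⇒multiples-gap M<L LF≤MF+y

appended-fib-gap : ∀ {M d j r m k} → luc j ≢ M → j + r ≡ m → j + m ≡ k →
  fib k ≡ M * fib m + d → fib m ≤ d + fib r
appended-fib-gap {M} {d} {j} {r} {m} L≢M j+r≡m refl fk = ≢⇒multiples-gap L≢M LF≤MF+y MF≤LF+y
  where
  open ≤-Reasoning
  F = fib m
  L = luc j
  identity : M * F + d + evenBit j * fib r ≡ L * F + oddBit j * fib r
  identity = trans (cong (_+ evenBit j * fib r) (sym fk)) (fib-luc j r j+r≡m)
  LF≤MF+y : L * F ≤ M * F + (d + fib r)
  LF≤MF+y = begin
    L * F                             ≤⟨ m≤m+n (L * F) _ ⟩
    L * F + oddBit j * fib r          ≡⟨ identity ⟨
    M * F + d + evenBit j * fib r     ≤⟨ +-monoʳ-≤ (M * F + d) (evenBit-*-≤ j (fib r)) ⟩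
    M * F + d + fib r                 ≡⟨ +-assoc (M * F) d (fib r) ⟩
    M * F + (d + fib r)               ∎
  MF≤LF+y : M * F ≤ L * F + (d + fib r)
  MF≤LF+y = begin
    M * F                             ≤⟨ m≤m+n (M * F) _ ⟩
    M * F + (d + evenBit j * fib r)   ≡⟨ +-assoc (M * F) d _ ⟨
    M * F + d + evenBit j * fib r     ≡⟨ identity ⟩
    L * F + oddBit j * fib r          ≤⟨ +-monoʳ-≤ (L * F) (oddBit-*-≤ j (fib r)) ⟩
    L * F + fib r                     ≤⟨ +-monoʳ-≤ (L * F) (m≤n+m (fib r) d) ⟩
    L * F + (d + fib r)               ∎

fib≤d+fib⇒fib≤3d+1 : ∀ {d r m} → r < m → fib m ≤ d + fib r → fib m ≤ 3 * d + 1
fib≤d+fib⇒fib≤3d+1 {d} {r} {suc p} (s≤s r≤p) F≤d+fib[r] = cancel-2F (begin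
  3 * fib (suc p)                ≤⟨ *-monoʳ-≤ 3 F≤d+fib[r] ⟩
  3 * (d + fib r)                ≡⟨ *-distribˡ-+ 3 d (fib r) ⟩
  3 * d + 3 * fib r              ≤⟨ +-monoʳ-≤ (3 * d) (*-monoʳ-≤ 3 (fib-mono-≤ r≤p)) ⟩
  3 * d + 3 * fib p              ≤⟨ +-monoʳ-≤ (3 * d) (3*fib≤2*fib[1+n]+1 p) ⟩
  3 * d + (2 * fib (suc p) + 1)  ∎)
  where
  open ≤-Reasoning
  cancel-2F : ∀ {F e} → 3 * F ≤ e + (2 * F + 1) → F ≤ e + 1
  cancel-2F {F} {e} 3F≤e+2F+1 = +-cancelˡ-≤ (2 * F) F (e + 1) (begin
    2 * F + F        ≡⟨ solve (F ∷ []) ⟩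
    3 * F            ≤⟨ 3F≤e+2F+1 ⟩
    e + (2 * F + 1)  ≡⟨ solve (F ∷ e ∷ []) ⟩
    2 * F + (e + 1)  ∎)

fib-not-appended-below : ∀ {M d m k} → 2 ≤ M → 0 < fib m → k ≤ m → fib k ≢ M * fib m + d
fib-not-appended-below {M} {d} {m} {k} 2≤M 0<F k≤m fk = <-irrefl refl (begin-strict
  F          <⟨ m<m+n F 0<F ⟩
  F + F      ≡⟨ cong (F +_) (+-identityʳ F) ⟨
  2 * F      ≤⟨ *-monoˡ-≤ F 2≤M ⟩
  M * F      ≤⟨ m≤m+n (M * F) d ⟩
  M * F + d  ≡⟨ fk ⟨
  fib k      ≤⟨ fib-mono-≤ k≤m ⟩
  F          ∎)
  where
  open ≤-Reasoning
  F = fib m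

fib-not-appended-above-double : ∀ {M d m k} → M < fib m → d < fib m → m + m ≤ k → fib k ≢ M * fib m + d
fib-not-appended-above-double {M} {d} {m} {k} M<F d<F 2m≤k fk = <-irrefl refl (begin-strict
  M * F + d      <⟨ +-monoʳ-< (M * F) d<F ⟩
  M * F + F      ≡⟨ +-comm (M * F) F ⟩
  suc M * F      ≤⟨ *-monoˡ-≤ F M<F ⟩
  F * F          ≤⟨ *-monoˡ-≤ F (fib≤luc m) ⟩
  luc m * F      ≡⟨ fib[m+m]≡luc[m]*fib[m] m ⟨
  fib (m + m)    ≤⟨ fib-mono-≤ 2m≤k ⟩
  fib k          ≡⟨ fk ⟩
  M * F + d      ∎)
  where
  open ≤-Reasoning
  F = fib m

between-m-and-m+m : ∀ {m k} → m < k → k < m + m → ∃₂ λ j r → 0 < j × j + r ≡ m × j + m ≡ k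
between-m-and-m+m {m} {k} m<k k<m+m =
  k ∸ m , m ∸ (k ∸ m) , m<n⇒0<n∸m m<k , m+[n∸m]≡n j≤m , j+m≡k
  where
  j+m≡k : k ∸ m + m ≡ k
  j+m≡k = m∸n+n≡m (<⇒≤ m<k)
  j≤m : k ∸ m ≤ m
  j≤m = <⇒≤ (+-cancelʳ-< m (k ∸ m) m (subst (_< m + m) (sym j+m≡k) k<m+m))

fib-not-appended : ∀ {M d} m k → (∀ j → luc j ≢ M) → d < M → 3 * M ≤ fib m → fib k ≢ M * fib m + d
fib-not-appended {M} {d} m k non-lucas d<M 3M≤F = by-position (k ≤? m) (m + m ≤? k)
  where
  0<M : 0 < M
  0<M = ≤-<-trans z≤n d<M
  M<F : M < fib m
  M<F = <-≤-trans (m<m+n M (≤-trans 0<M (m≤m+n M _))) 3M≤F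
  d<F : d < fib m
  d<F = <-trans d<M M<F
  3d+1<3M : 3 * d + 1 < 3 * M
  3d+1<3M = begin-strict
    3 * d + 1  <⟨ +-monoʳ-< (3 * d) (s≤s (s≤s z≤n)) ⟩
    3 * d + 3  ≡⟨ solve (d ∷ []) ⟩
    3 * suc d  ≤⟨ *-monoʳ-≤ 3 d<M ⟩
    3 * M      ∎
    where open ≤-Reasoning
  middle : (∃₂ λ j r → 0 < j × j + r ≡ m × j + m ≡ k) → fib k ≢ M * fib m + d
  middle (j , r , 0<j , j+r≡m , j+m≡k) fk = <⇒≱ 3d+1<3M (≤-trans 3M≤F
    (fib≤d+fib⇒fib≤3d+1 (subst (r <_) j+r≡m (m<n+m r 0<j)) (appended-fib-gap (non-lucas j) j+r≡m j+m≡k fk)))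
  by-position : Dec (k ≤ m) → Dec (m + m ≤ k) → fib k ≢ M * fib m + d
  by-position (yes k≤m) _          = fib-not-appended-below {m = m} (≤∧≢⇒< 0<M (non-lucas 1)) (≤-<-trans z≤n d<F) k≤m
  by-position (no _)    (yes 2m≤k) = fib-not-appended-above-double {m = m} M<F d<F 2m≤k
  by-position (no k≰m)  (no 2m≰k)  = middle (between-m-and-m+m (≰⇒> k≰m) (≰⇒> 2m≰k))

appended-fib<3*M : ∀ {M d} m k → (∀ j → luc j ≢ M) → d < M → fib k ≡ M * fib m + d → fib m < 3 * M
appended-fib<3*M {M} m k non-lucas d<M fk with fib m <? 3 * M
... | yes F<3M = F<3M
... | no  F≮3M = contradiction fk (fib-not-appended m k non-lucas d<M (≮⇒≥ F≮3M))

luc≢10^N : ∀ {N} → 1 ≤ N → ∀ j → luc j ≢ 10 ^ N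
luc≢10^N {suc n} _ j luc≡10^N = 5∤luc j (subst (5 ∣_) (sym luc≡10^N) (∣-trans (divides 2 refl) (m∣m*n (10 ^ n))))

m≤n∸1⇒m<n : ∀ {m n} → 0 < n → m ≤ n ∸ 1 → m < n
m≤n∸1⇒m<n {n = suc n} _ m≤n = s≤s m≤n

digit-bound : (N : ℕ) → 1 ≤ N → (F d : ℕ) → IsFib F → 0 < F → d ≤ 10 ^ N ∸ 1 → IsFib (10 ^ N * F + d) →
  F < 10 ^ (N + 1)
digit-bound N 1≤N F d (m , refl) _ d≤10^N∸1 (k , fk) = begin-strict
  fib m       <⟨ appended-fib<3*M m k (luc≢10^N 1≤N) (m≤n∸1⇒m<n (m^n>0 10 N) d≤10^N∸1) fk ⟩
  3 * 10 ^ N  ≤⟨ *-monoˡ-≤ (10 ^ N) 3≤10 ⟩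
  10 * 10 ^ N ≡⟨ cong (10 ^_) (+-comm 1 N) ⟩
  10 ^ (N + 1) ∎
  where
  open ≤-Reasoning
  3≤10 : 3 ≤ 10
  3≤10 = s≤s (s≤s (s≤s z≤n))

appends⇒≥ : ∀ N {a b} → Appends N a b → 10 ^ N * a ≤ b
appends⇒≥ N (d , _ , refl) = m≤m+n _ d

no-three-appends : ∀ N → 1 ≤ N → ∀ {a b c e} → 0 < a → IsFib c → 0 < c → IsFib e →
  Appends N a b → Appends N b c → Appends N c e → ⊥
no-three-appends N 1≤N {a} {b} {c} 0<a c-fib 0<c e-fib a→b b→c (d , d≤10^N∸1 , e≡) =
  <-irrefl refl (begin-strict
    c            <⟨ digit-bound N 1≤N c d c-fib 0<c d≤10^N∸1 (subst IsFib e≡ e-fib) ⟩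
    10 ^ (N + 1) ≡⟨ cong (10 ^_) (+-comm N 1) ⟩
    10 * M       ≤⟨ *-monoˡ-≤ M (^-monoʳ-≤ 10 1≤N) ⟩
    M * M        ≤⟨ *-monoʳ-≤ M M≤b ⟩
    M * b        ≤⟨ appends⇒≥ N b→c ⟩
    c            ∎)
  where
  open ≤-Reasoning
  M = 10 ^ N
  M≤b : M ≤ b
  M≤b = ≤-trans (≤-trans (≤-reflexive (sym (*-identityʳ M))) (*-monoʳ-≤ M 0<a)) (appends⇒≥ N a→b)

chain-length : ∀ N → 1 ≤ N → (as : List ℕ) → All (λ a → IsFib a × 0 < a) as → Linked (Appends N) as →
  length as ≤ 3
chain-length N _   []                  _ _ = z≤n
chain-length N _   (_ ∷ [])            _ _ = s≤s z≤n
chain-length N _   (_ ∷ _ ∷ [])        _ _ = s≤s (s≤s z≤n)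
chain-length N _   (_ ∷ _ ∷ _ ∷ [])    _ _ = s≤s (s≤s (s≤s z≤n))
chain-length N 1≤N (_ ∷ _ ∷ _ ∷ _ ∷ _)
  ((_ , 0<a) All.∷ _ All.∷ (c-fib , 0<c) All.∷ (e-fib , _) All.∷ _) (a→b Linked.∷ b→c Linked.∷ c→e Linked.∷ _) =
  ⊥-elim (no-three-appends N 1≤N 0<a c-fib 0<c e-fib a→b b→c c→e)

corollary2p5 : (N : ℕ) → 1 ≤ N →
    ((F d : ℕ) → IsFib F → 0 < F → d ≤ 10 ^ N ∸ 1 → IsFib (10 ^ N * F + d) →
      F < 10 ^ (N + 1))
    × ((as : List ℕ) → All (λ a → IsFib a × 0 < a) as → Linked (Appends N) as →
      length as ≤ 3)
corollary2p5 N 1≤N = digit-bound N 1≤N , chain-length N 1≤N
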